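{- Let $G$ be a connected graph with an odd number of vertices and independence number $2$. Then either $G$ is factor-critical, or $G$ is the union of two vertex-disjoint complete graphs, one with an even and one with an odd number of vertices, together with a set of edges between them that are pairwise incident (i.e. all share a common endpoint).
   Context: All graphs are finite, simple and undirected. A graph is factor-critical if $G-v$ has a perfect matching for every vertex $v$. The independence number is the maximum size of an independent set of vertices. -}

module Defs where

open import Data.Nat using (ℕ; suc; _+_; _*_; _≤_)
open import Data.Fin using (Fin)
open import Data.Fin.Subset using (Subset; _∈_; _∉_; ∁; ∣_∣)
open import Data.Bool using (Bool; true; false; T)
open import Data.Product using (Σ; ∃; _×_; _,_)
open import Data.Sum using (_⊎_)
open import Relation.Binary.PropositionalEquality using (_≡_; _≢_)
open import Relation.Nullary using (¬_)

record Graph (n : ℕ) : Set where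
  field
    adj     : Fin n → Fin n → Bool
    symm    : ∀ u v → adj u v ≡ adj v u
    irrefl  : ∀ v → adj v v ≡ false

open Graph public

Adj : ∀ {n} → Graph n → Fin n → Fin n → Set
Adj G u v = T (adj G u v)

Even : ℕ → Set
Even m = ∃ λ k → m ≡ 2 * k

Odd : ℕ → Set
Odd m = ∃ λ k → m ≡ suc (2 * k)

data Walk {n : ℕ} (G : Graph n) : Fin n → Fin n → Set where
  here : ∀ {u} → Walk G u u
  step : ∀ {u w v} → Adj G u w → Walk G w v → Walk G u v

Connected : ∀ {n} → Graph n → Set
Connected {n} G = ∀ (u v : Fin n) → Walk G u v

Independent : ∀ {n} → Graph n → Subset n → Set
Independent G S = ∀ u v → u ∈ S → v ∈ S → ¬ Adj G u v

IndependenceNumber : ∀ {n} → Graph n → ℕ → Set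
IndependenceNumber {n} G k =
  (∃ λ (S : Subset n) → Independent G S × ∣ S ∣ ≡ k) ×
  (∀ (S : Subset n) → Independent G S → ∣ S ∣ ≤ k)

-- The matching is the
-- edge set { {u, m u} | u ≠ v }.
PerfectMatchingMinus : ∀ {n} → Graph n → Fin n → Set
PerfectMatchingMinus {n} G v =
  Σ (Fin n → Fin n) λ m →
    ∀ u → u ≢ v → (m u ≢ v) × Adj G u (m u) × (m (m u) ≡ u)

FactorCritical : ∀ {n} → Graph n → Set
FactorCritical {n} G = ∀ (v : Fin n) → PerfectMatchingMinus G v

Clique : ∀ {n} → Graph n → Subset n → Set
Clique G S = ∀ u v → u ∈ S → v ∈ S → u ≢ v → Adj G u v

TwoCliquesStar : ∀ {n} → Graph n → Set
TwoCliquesStar {n} G =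
  Σ (Subset n) λ A →
    Even ∣ A ∣ × Odd ∣ ∁ A ∣ × Clique G A × Clique G (∁ A) ×
    (∃ λ (w : Fin n) → ∀ a b → a ∈ A → b ∉ A → Adj G a b → (a ≡ w) ⊎ (b ≡ w))

-- Fix a vertex v and run the augmenting-path method on G − v, a matching being
-- given by its partner involution m with m v = v, whose fixed points are the
-- unmatched vertices.  An involution of the odd set V has an odd number of fixed
-- points, so besides v either no vertex is unmatched (a perfect matching of G − v)
-- or at least two are.  Among three unmatched vertices two are adjacent, since
-- α(G) = 2.  If exactly u and w are unmatched, augment along a path of length
-- 1, 3 or 5 when there is one.  Otherwise let U consist of u and the matched
-- neighbours of u, and W of w and the other matched vertices: α(G) = 2 and the
-- missing augmenting paths make U and W cliques closed under m with no edges
-- between them, so both have odd size; v is adjacent to all of U or to all of W,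
-- and adding v to that side gives the two cliques of the second alternative.

module Submission where

open import Defs
open import Level using (Level; 0ℓ)
open import Data.Nat using (ℕ; zero; suc; _+_; _*_; _≤_; _<_; s≤s)
open import Data.Nat.Properties using (+-identityʳ; n<1+n; m<n⇒m<1+n; suc-injective; even≢odd)
open import Data.Nat.Induction using (<-rec)
open import Data.Nat.Tactic.RingSolver using (solve-∀)
open import Data.Fin using (Fin; zero; suc)
open import Data.Fin.Properties using (_≟_; any?) renaming (suc-injective to Fin-suc-injective)
open import Data.Fin.Subset using (Subset; ∁; ∣_∣) renaming (_∈_ to _∈ₛ_; _∉_ to _∉ₛ_)
open import Data.Vec using (tabulate)
open import Data.Vec.Properties using (lookup∘tabulate; []=⇒lookup; lookup⇒[]=; tabulate-∘)
open import Data.List using (List; []; _∷_; length)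
open import Data.List.Relation.Unary.Any using (here; there)
open import Data.List.Relation.Unary.All as All using ([]; _∷_)
open import Data.List.Relation.Unary.AllPairs using (AllPairs; []; _∷_)
open import Data.List.Relation.Unary.Unique.Propositional using (Unique)
import Data.List.Membership.DecPropositional as DecMembership
open import Data.Bool using (T; not)
open import Data.Bool.Properties using (T?)
open import Data.Product using (∃; _×_; _,_; proj₁; proj₂)
open import Data.Sum as Sum using (_⊎_; inj₁; inj₂)
open import Data.Empty using (⊥)
open import Data.Unit using (tt)
open import Function using (_∘_; flip)
open import Relation.Binary.PropositionalEquality
open import Relation.Nullary using (¬_; Dec; yes; no; contradiction)
open import Relation.Nullary.Decidable using (does; proof; dec-true; ¬?; _×-dec_; _⊎-dec_; decidable-stable)
open import Relation.Nullary.Reflects using (Reflects; invert)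
open import Relation.Unary using (Pred; Decidable; _≐_; _⊆_; _∪_; _∩_; _∖_; ｛_｝)
open import Relation.Unary.Properties using (∁?; _∪?_; _∩?_)

private variable
  n : ℕ
  p q ℓ : Level

module _ {n : ℕ} where
  open DecMembership (_≟_ {n}) public using (_∈?_) renaming (_∈_ to _∈ₗ_)

-- Counting decidable subsets of Fin n

+2*-suc : ∀ a k → suc (suc (a + 2 * k)) ≡ a + 2 * suc k
+2*-suc = solve-∀

infixl 6 _─?_

_─?_ : {P : Pred (Fin n) p} → Decidable P → (j : Fin n) → Decidable (P ∖ ｛ j ｝)
P? ─? j = P? ∩? ∁? (j ≟_)

opaque
  subset : {P : Pred (Fin n) p} → Decidable P → Subset n
  subset P? = tabulate (does ∘ P?)

  count : {P : Pred (Fin n) p} → Decidable P → ℕ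
  count P? = ∣ subset P? ∣

  ∣subset∣≡count : {P : Pred (Fin n) p} (P? : Decidable P) → ∣ subset P? ∣ ≡ count P?
  ∣subset∣≡count P? = refl

  ∈-subset⁻ : {P : Pred (Fin n) p} (P? : Decidable P) {i : Fin n} → i ∈ₛ subset P? → P i
  ∈-subset⁻ {P = P} P? {i} i∈ =
    invert (subst (Reflects (P i))
      (trans (sym (lookup∘tabulate _ i)) ([]=⇒lookup i∈)) (proof (P? i)))

  ∈-subset⁺ : {P : Pred (Fin n) p} (P? : Decidable P) {i : Fin n} → P i → i ∈ₛ subset P?
  ∈-subset⁺ P? {i} Pi = lookup⇒[]= i _ (trans (lookup∘tabulate _ i) (dec-true (P? i) Pi))

  ∁-subset : {P : Pred (Fin n) p} (P? : Decidable P) → ∁ (subset P?) ≡ subset (∁? P?)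
  ∁-subset P? = sym (tabulate-∘ not (does ∘ P?))

  count-cong : {P : Pred (Fin n) p} {Q : Pred (Fin n) q} (P? : Decidable P) (Q? : Decidable Q) →
               P ≐ Q → count P? ≡ count Q?
  count-cong {n = zero} P? Q? P≐Q = refl
  count-cong {n = suc n} P? Q? (P⊆Q , Q⊆P) with P? zero | Q? zero
  ... | yes _ | yes _ = cong suc (count-cong (P? ∘ suc) (Q? ∘ suc) (P⊆Q , Q⊆P))
  ... | no _  | no _  = count-cong (P? ∘ suc) (Q? ∘ suc) (P⊆Q , Q⊆P)
  ... | yes p | no ¬q = contradiction (P⊆Q p) ¬q
  ... | no ¬p | yes q = contradiction (Q⊆P q) ¬p

  private
    count-─?-suc : {P : Pred (Fin (suc n)) p} (P? : Decidable P) {j : Fin n} →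
                   count ((P? ∘ suc) ─? j) ≡ count ((P? ─? suc j) ∘ suc)
    count-─?-suc P? {j} = count-cong ((P? ∘ suc) ─? j) ((P? ─? suc j) ∘ suc)
      ((λ (Pi , j≢i) → Pi , j≢i ∘ Fin-suc-injective) , (λ (Pi , sj≢si) → Pi , sj≢si ∘ cong suc))

  count-remove : {P : Pred (Fin n) p} (P? : Decidable P) {j : Fin n} →
                 P j → count P? ≡ suc (count (P? ─? j))
  count-remove {n = suc n} P? {zero} Pj with P? zero
  ... | yes _ = cong suc (count-cong (P? ∘ suc) ((P? ─? zero) ∘ suc) ((λ Pi → Pi , λ ()) , proj₁))
  ... | no ¬Pj = contradiction Pj ¬Pj
  count-remove {n = suc n} P? {suc j} Pj with P? zero
  ... | yes _ = cong suc (trans (count-remove (P? ∘ suc) Pj) (cong suc (count-─?-suc P? {j})))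
  ... | no _  = trans (count-remove (P? ∘ suc) Pj) (cong suc (count-─?-suc P? {j}))

  count-remove₂ : {P : Pred (Fin n) p} (P? : Decidable P) {i j : Fin n} →
                  P i → P j → i ≢ j → count P? ≡ suc (suc (count (P? ─? i ─? j)))
  count-remove₂ P? {i} Pi Pj i≢j = trans (count-remove P? Pi) (cong suc (count-remove (P? ─? i) (Pj , i≢j)))

  count-none : {P : Pred (Fin n) p} (P? : Decidable P) → (∀ i → ¬ P i) → count P? ≡ 0
  count-none {n = zero} P? none = refl
  count-none {n = suc n} P? none with P? zero
  ... | yes Pi = contradiction Pi (none zero)
  ... | no _ = count-none (P? ∘ suc) (none ∘ suc)

  count-all : {P : Pred (Fin n) p} (P? : Decidable P) → (∀ i → P i) → count P? ≡ n
  count-all {n = zero} P? all = refl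
  count-all {n = suc n} P? all with P? zero
  ... | yes _ = cong suc (count-all (P? ∘ suc) (all ∘ suc))
  ... | no ¬Pi = contradiction (all zero) ¬Pi

count-∈ : {xs : List (Fin n)} → Unique xs → count (_∈? xs) ≡ length xs
count-∈ {xs = []} [] = count-none (_∈? []) λ _ ()
count-∈ {xs = x ∷ xs} (x∉xs ∷ unique) =
  trans (count-remove (_∈? x ∷ xs) (here refl))
        (cong suc (trans (count-cong ((_∈? x ∷ xs) ─? x) (_∈? xs) (forth , back)) (count-∈ unique)))
  where
  forth : (_∈ₗ x ∷ xs) ∖ ｛ x ｝ ⊆ (_∈ₗ xs)
  forth (here refl , x≢x) = contradiction refl x≢x
  forth (there i∈xs , _)  = i∈xs
  back : (_∈ₗ xs) ⊆ (_∈ₗ x ∷ xs) ∖ ｛ x ｝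
  back i∈xs = there i∈xs , All.lookup x∉xs i∈xs

-- Involutions and their fixed points

module _ {n : ℕ} where

  Fixed : (Fin n → Fin n) → Pred (Fin n) 0ℓ
  Fixed m i = m i ≡ i

  fixed? : (m : Fin n → Fin n) → Decidable (Fixed m)
  fixed? m i = m i ≟ i

  unmatched : (Fin n → Fin n) → ℕ
  unmatched m = count (fixed? m)

  fixed≢moved : {m : Fin n → Fin n} {i j : Fin n} → m i ≡ i → m j ≢ j → i ≢ j
  fixed≢moved mi≡i mj≢j refl = mj≢j mi≡i

  record IsInvolution (m : Fin n → Fin n) : Set where
    field
      involutive : ∀ i → m (m i) ≡ i

    injective : ∀ {i j} → m i ≡ m j → i ≡ j
    injective {i} {j} mi≡mj = trans (sym (involutive i)) (trans (cong m mi≡mj) (involutive j))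

    partner-moved : ∀ {a} → m a ≢ a → m (m a) ≢ m a
    partner-moved {a} ma≢a mma≡ma = ma≢a (trans (sym mma≡ma) (involutive a))

    ≢-partner : ∀ {i a} → i ≢ m a → m i ≢ a
    ≢-partner {i} i≢ma mi≡a = i≢ma (trans (sym (involutive i)) (cong m mi≡a))

    ≢-fixed : ∀ {i j} → m j ≡ j → i ≢ j → m i ≢ j
    ≢-fixed {i} mj≡j i≢j mi≡j = i≢j (trans (sym (involutive i)) (trans (cong m mi≡j) mj≡j))

  open IsInvolution public

  fixed-parity : {m : Fin n → Fin n} → IsInvolution m → {P : Pred (Fin n) p} (P? : Decidable P) →
                 (∀ {i} → P i → P (m i)) → ∃ λ k → count P? ≡ count (P? ∩? fixed? m) + 2 * k
  fixed-parity {p = p} {m} I P? closed = <-rec Goal descend _ P? closed refl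
    where
    Goal : ℕ → Set _
    Goal c = ∀ {P : Pred (Fin n) p} (P? : Decidable P) → (∀ {i} → P i → P (m i)) →
             count P? ≡ c → ∃ λ k → count P? ≡ count (P? ∩? fixed? m) + 2 * k
    descend : ∀ c → (∀ {c′} → c′ < c → Goal c′) → Goal c
    descend _ rec {P} P? closed refl with any? (λ i → P? i ×-dec ¬? (fixed? m i))
    ... | no none =
      0 , trans (count-cong P? (P? ∩? fixed? m) ((λ Pi → Pi , fixed Pi) , proj₁)) (sym (+-identityʳ _))
      where
      fixed : ∀ {i} → P i → m i ≡ i
      fixed {i} Pi = decidable-stable (fixed? m i) λ mi≢i → none (i , Pi , mi≢i)
    ... | yes (i , Pi , mi≢i) = suc k , (begin
      count P?                                      ≡⟨ count-P ⟩
      suc (suc (count P′?))                         ≡⟨ cong (λ c → suc (suc c)) eq ⟩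
      suc (suc (count (P′? ∩? fixed? m) + 2 * k))   ≡⟨ cong (λ c → suc (suc (c + 2 * k))) fixed-same ⟩
      suc (suc (count (P? ∩? fixed? m) + 2 * k))    ≡⟨ +2*-suc (count (P? ∩? fixed? m)) k ⟩
      count (P? ∩? fixed? m) + 2 * suc k            ∎)
      where
      open ≡-Reasoning
      P′ : Pred (Fin n) p
      P′ = (P ∖ ｛ i ｝) ∖ ｛ m i ｝
      P′? : Decidable P′
      P′? = P? ─? i ─? m i
      count-P : count P? ≡ suc (suc (count P′?))
      count-P = count-remove₂ P? Pi (closed Pi) (mi≢i ∘ sym)
      closed′ : ∀ {j} → P′ j → P′ (m j)
      closed′ {j} ((Pj , i≢j) , mi≢j) =
        (closed Pj , λ i≡mj → mi≢j (trans (cong m i≡mj) (involutive I j))) , i≢j ∘ injective I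
      fixed-same : count (P′? ∩? fixed? m) ≡ count (P? ∩? fixed? m)
      fixed-same = count-cong (P′? ∩? fixed? m) (P? ∩? fixed? m)
        ((λ (((Pj , _) , _) , mj≡j) → Pj , mj≡j) ,
         (λ { (Pj , mj≡j) → ((Pj , λ { refl → mi≢i mj≡j }) , λ { refl → partner-moved I mi≢i mj≡j }) , mj≡j }))
      ih : ∃ λ k → count P′? ≡ count (P′? ∩? fixed? m) + 2 * k
      ih = rec (subst (count P′? <_) (sym count-P) (m<n⇒m<1+n (n<1+n _))) P′? closed′ refl
      k : ℕ
      k = proj₁ ih
      eq : count P′? ≡ count (P′? ∩? fixed? m) + 2 * k
      eq = proj₂ ih

  fixed-points-parity : {m : Fin n → Fin n} → IsInvolution m → {P : Pred (Fin n) p} (P? : Decidable P) →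
                        (∀ {i} → P i → P (m i)) → {xs : List (Fin n)} → Unique xs →
                        P ∩ Fixed m ≐ (_∈ₗ xs) → ∃ λ k → count P? ≡ length xs + 2 * k
  fixed-points-parity {m = m} I P? closed {xs} unique fixed≐xs with fixed-parity I P? closed
  ... | k , eq = k , trans eq (cong (_+ 2 * k) (trans (count-cong (P? ∩? fixed? m) (_∈? xs) fixed≐xs)
                                                      (count-∈ unique)))

  two-fixed-points⇒even : {m : Fin n → Fin n} → IsInvolution m → ∀ {a b} → a ≢ b →
                          Fixed m ≐ (_∈ₗ a ∷ b ∷ []) → Even n
  two-fixed-points⇒even I a≢b fixed≐ab
    with fixed-points-parity I (λ _ → yes tt) (λ _ → tt) ((a≢b ∷ []) ∷ [] ∷ [])
           ((λ (_ , fixed) → proj₁ fixed≐ab fixed) , λ i∈ → tt , proj₂ fixed≐ab i∈)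
  ... | k , eq = suc k , trans (sym (count-all (λ _ → yes tt) (λ _ → tt))) (trans eq (+2*-suc 0 k))

  opaque
    match : Fin n → Fin n → (Fin n → Fin n) → Fin n → Fin n
    match p q m i with i ≟ p | i ≟ q
    ... | yes _ | _     = q
    ... | no _  | yes _ = p
    ... | no _  | no _  = m i

    match-at-p : {p q : Fin n} {m : Fin n → Fin n} → match p q m p ≡ q
    match-at-p {p} with p ≟ p
    ... | yes _  = refl
    ... | no p≢p = contradiction refl p≢p

    match-at-q : {p q : Fin n} {m : Fin n → Fin n} → p ≢ q → match p q m q ≡ p
    match-at-q {p} {q} p≢q with q ≟ p | q ≟ q
    ... | yes q≡p | _      = contradiction (sym q≡p) p≢q
    ... | no _    | yes _  = refl
    ... | no _    | no q≢q = contradiction refl q≢q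

    match-elsewhere : {p q : Fin n} {m : Fin n → Fin n} {i : Fin n} → i ≢ p → i ≢ q → match p q m i ≡ m i
    match-elsewhere {p} {q} {i = i} i≢p i≢q with i ≟ p | i ≟ q
    ... | yes i≡p | _       = contradiction i≡p i≢p
    ... | no _    | yes i≡q = contradiction i≡q i≢q
    ... | no _    | no _    = refl

  module _ {p q : Fin n} {m : Fin n → Fin n} (mp≡p : m p ≡ p) (mq≡q : m q ≡ q) (p≢q : p ≢ q) where

    match-isInvolution : IsInvolution m → IsInvolution (match p q m)
    match-isInvolution I = record { involutive = λ i → cases i (i ≟ p) (i ≟ q) }
      where
      cases : ∀ i → Dec (i ≡ p) → Dec (i ≡ q) → match p q m (match p q m i) ≡ i
      cases i (yes refl) _          = trans (cong (match p q m) match-at-p) (match-at-q p≢q)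
      cases i (no _)     (yes refl) = trans (cong (match p q m) (match-at-q p≢q)) match-at-p
      cases i (no i≢p)   (no i≢q)   = trans (cong (match p q m) (match-elsewhere i≢p i≢q))
        (trans (match-elsewhere (≢-fixed I mp≡p i≢p) (≢-fixed I mq≡q i≢q)) (involutive I i))

    unmatched-match : unmatched m ≡ suc (suc (unmatched (match p q m)))
    unmatched-match =
      trans (count-remove₂ (fixed? m) mp≡p mq≡q p≢q)
            (cong (λ c → suc (suc c)) (count-cong (fixed? m ─? p ─? q) (fixed? (match p q m)) (forth , back)))
      where
      forth : (Fixed m ∖ ｛ p ｝) ∖ ｛ q ｝ ⊆ Fixed (match p q m)
      forth ((mi≡i , p≢i) , q≢i) = trans (match-elsewhere (p≢i ∘ sym) (q≢i ∘ sym)) mi≡i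
      back : Fixed (match p q m) ⊆ (Fixed m ∖ ｛ p ｝) ∖ ｛ q ｝
      back {i} fixed = (trans (sym (match-elsewhere i≢p i≢q)) fixed , i≢p ∘ sym) , i≢q ∘ sym
        where
        i≢p : i ≢ p
        i≢p refl = p≢q (sym (trans (sym match-at-p) fixed))
        i≢q : i ≢ q
        i≢q refl = p≢q (trans (sym (match-at-q p≢q)) fixed)

  opaque
    unmatch : Fin n → (Fin n → Fin n) → Fin n → Fin n
    unmatch a m i with i ≟ a | i ≟ m a
    ... | no _  | no _  = m i
    ... | yes _ | _     = i
    ... | no _  | yes _ = i

    unmatch-at-a : {a : Fin n} {m : Fin n → Fin n} → unmatch a m a ≡ a
    unmatch-at-a {a} with a ≟ a
    ... | yes _  = refl
    ... | no a≢a = contradiction refl a≢a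

    unmatch-at-partner : {a : Fin n} {m : Fin n → Fin n} → unmatch a m (m a) ≡ m a
    unmatch-at-partner {a} {m} with m a ≟ a | m a ≟ m a
    ... | yes _ | _        = refl
    ... | no _  | yes _    = refl
    ... | no _  | no ma≢ma = contradiction refl ma≢ma

    unmatch-elsewhere : {a : Fin n} {m : Fin n → Fin n} {i : Fin n} → i ≢ a → i ≢ m a → unmatch a m i ≡ m i
    unmatch-elsewhere {a} {m} {i} i≢a i≢ma with i ≟ a | i ≟ m a
    ... | no _    | no _     = refl
    ... | yes i≡a | _        = contradiction i≡a i≢a
    ... | no _    | yes i≡ma = contradiction i≡ma i≢ma

  module _ {a : Fin n} {m : Fin n → Fin n} (I : IsInvolution m) where

    unmatch-isInvolution : IsInvolution (unmatch a m)
    unmatch-isInvolution = record { involutive = λ i → cases i (i ≟ a) (i ≟ m a) }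
      where
      cases : ∀ i → Dec (i ≡ a) → Dec (i ≡ m a) → unmatch a m (unmatch a m i) ≡ i
      cases i (yes refl) _          = trans (cong (unmatch a m) unmatch-at-a) unmatch-at-a
      cases i (no _)     (yes refl) = trans (cong (unmatch a m) unmatch-at-partner) unmatch-at-partner
      cases i (no i≢a)   (no i≢ma)  = trans (cong (unmatch a m) (unmatch-elsewhere i≢a i≢ma))
        (trans (unmatch-elsewhere (≢-partner I i≢ma) (i≢a ∘ injective I)) (involutive I i))

    unmatch-fixes : ∀ {i} → m i ≡ i → unmatch a m i ≡ i
    unmatch-fixes {i} mi≡i with i ≟ a
    ... | yes refl = unmatch-at-a
    ... | no i≢a   = trans (unmatch-elsewhere i≢a (≢-fixed I mi≡i (i≢a ∘ sym) ∘ sym)) mi≡i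

    unmatched-unmatch : m a ≢ a → unmatched (unmatch a m) ≡ suc (suc (unmatched m))
    unmatched-unmatch ma≢a =
      trans (count-remove₂ (fixed? (unmatch a m)) unmatch-at-a unmatch-at-partner (ma≢a ∘ sym))
            (cong (λ c → suc (suc c)) (count-cong (fixed? (unmatch a m) ─? a ─? m a) (fixed? m) (forth , back)))
      where
      forth : (Fixed (unmatch a m) ∖ ｛ a ｝) ∖ ｛ m a ｝ ⊆ Fixed m
      forth ((fixed , a≢i) , ma≢i) = trans (sym (unmatch-elsewhere (a≢i ∘ sym) (ma≢i ∘ sym))) fixed
      back : Fixed m ⊆ (Fixed (unmatch a m) ∖ ｛ a ｝) ∖ ｛ m a ｝
      back mi≡i = (unmatch-fixes mi≡i , λ { refl → ma≢a mi≡i }) , λ { refl → partner-moved I ma≢a mi≡i }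

  shift : Fin n → Fin n → (Fin n → Fin n) → Fin n → Fin n
  shift u a m = match u a (unmatch a m)

  module _ {u a : Fin n} {m : Fin n → Fin n} (I : IsInvolution m) (mu≡u : m u ≡ u) (ma≢a : m a ≢ a) where

    private
      u≢a : u ≢ a
      u≢a = fixed≢moved mu≡u ma≢a

      ma≢u : m a ≢ u
      ma≢u = fixed≢moved mu≡u (partner-moved I ma≢a) ∘ sym

    shift-frees : shift u a m (m a) ≡ m a
    shift-frees = trans (match-elsewhere ma≢u ma≢a) unmatch-at-partner

    shift-elsewhere : ∀ {i} → i ≢ u → i ≢ a → i ≢ m a → shift u a m i ≡ m i
    shift-elsewhere i≢u i≢a i≢ma = trans (match-elsewhere i≢u i≢a) (unmatch-elsewhere i≢a i≢ma)

    unmatched-shift : unmatched (shift u a m) ≡ unmatched m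
    unmatched-shift = suc-injective (suc-injective (trans
      (sym (unmatched-match (unmatch-fixes I mu≡u) unmatch-at-a u≢a))
      (unmatched-unmatch I ma≢a)))

-- Independence number 2, and matchings of G − v

module _ {n : ℕ} (G : Graph n) where

  Adj? : ∀ a b → Dec (Adj G a b)
  Adj? a b = T? (adj G a b)

  Adj-sym : ∀ {a b} → Adj G a b → Adj G b a
  Adj-sym {a} {b} = subst T (symm G a b)

  Adj⇒≢ : ∀ {a b} → Adj G a b → a ≢ b
  Adj⇒≢ {a} a~a refl = subst T (irrefl G a) a~a

  NonAdjacentPairs : List (Fin n) → Set
  NonAdjacentPairs = AllPairs (λ a b → ¬ Adj G a b)

  nonAdjacent-∈ : ∀ {xs a b} → NonAdjacentPairs xs → a ∈ₗ xs → b ∈ₗ xs → ¬ Adj G a b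
  nonAdjacent-∈ _       (here refl) (here refl) a~a = Adj⇒≢ a~a refl
  nonAdjacent-∈ (h ∷ _) (here refl) (there b∈)     = All.lookup h b∈
  nonAdjacent-∈ (h ∷ _) (there a∈)  (here refl)    = All.lookup h a∈ ∘ Adj-sym
  nonAdjacent-∈ (_ ∷ t) (there a∈)  (there b∈)     = nonAdjacent-∈ t a∈ b∈

  independent-list-bound : ∀ {k} → (∀ S → Independent G S → ∣ S ∣ ≤ k) →
                           ∀ {xs} → Unique xs → NonAdjacentPairs xs → length xs ≤ k
  independent-list-bound bound {xs} unique nonAdjacent =
    subst (_≤ _) (trans (∣subset∣≡count (_∈? xs)) (count-∈ unique))
      (bound (subset (_∈? xs)) λ a b a∈ b∈ →
        nonAdjacent-∈ nonAdjacent (∈-subset⁻ (_∈? xs) a∈) (∈-subset⁻ (_∈? xs) b∈))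

  module _ (α≤2 : ∀ S → Independent G S → ∣ S ∣ ≤ 2) where

    no-independent-triple : ∀ {x y z} → x ≢ y → x ≢ z → y ≢ z →
                            ¬ Adj G x y → ¬ Adj G x z → ¬ Adj G y z → ⊥
    no-independent-triple x≢y x≢z y≢z x≁y x≁z y≁z
      with independent-list-bound α≤2 ((x≢y ∷ x≢z ∷ []) ∷ (y≢z ∷ []) ∷ [] ∷ [])
                                       ((x≁y ∷ x≁z ∷ []) ∷ (y≁z ∷ []) ∷ [] ∷ [])
    ... | s≤s (s≤s ())

    adjacent-of-non-neighbours : ∀ {x y z} → x ≢ y → x ≢ z → y ≢ z →
                                 ¬ Adj G x y → ¬ Adj G x z → Adj G y z
    adjacent-of-non-neighbours {y = y} {z} x≢y x≢z y≢z x≁y x≁z =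
      decidable-stable (Adj? y z) (no-independent-triple x≢y x≢z y≢z x≁y x≁z)

  record TwoCliquesMinus (v : Fin n) (X Y : Pred (Fin n) ℓ) : Set ℓ where
    field
      cover    : ∀ {i} → i ≢ v → X i ⊎ Y i
      disjoint : ∀ {i} → X i → ¬ Y i
      v∉X      : ¬ X v
      v∉Y      : ¬ Y v
      X-clique : ∀ {a b} → X a → X b → a ≢ b → Adj G a b
      Y-clique : ∀ {a b} → Y a → Y b → a ≢ b → Adj G a b
      no-cross : ∀ {a b} → X a → Y b → ¬ Adj G a b

  swap-sides : ∀ {v} {X Y : Pred (Fin n) ℓ} → TwoCliquesMinus v X Y → TwoCliquesMinus v Y X
  swap-sides T = record
    { cover    = Sum.swap ∘ cover
    ; disjoint = λ Yi Xi → disjoint Xi Yi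
    ; v∉X      = v∉Y
    ; v∉Y      = v∉X
    ; X-clique = Y-clique
    ; Y-clique = X-clique
    ; no-cross = λ Ya Xb a~b → no-cross Xb Ya (Adj-sym a~b)
    }
    where open TwoCliquesMinus T

  twoCliquesStar : ∀ {v} {X Y : Pred (Fin n) ℓ} (X? : Decidable X) (Y? : Decidable Y) →
                   TwoCliquesMinus v X Y → (∀ {a} → X a → Adj G v a) →
                   Odd (count X?) → Odd (count Y?) → TwoCliquesStar G
  twoCliquesStar {ℓ = ℓ} {v = v} {X} {Y} X? Y? T v~X (k , |X|≡) (l , |Y|≡) =
    subset A? , even-A , odd-B , A-clique , B-clique , v , cross
    where
    open TwoCliquesMinus T
    A : Pred (Fin n) ℓ
    A = ｛ v ｝ ∪ X
    A? : Decidable A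
    A? = (v ≟_) ∪? X?
    ¬A⇒Y : ∀ {i} → ¬ A i → Y i
    ¬A⇒Y ¬Ai with cover (¬Ai ∘ inj₁ ∘ sym)
    ... | inj₁ Xi = contradiction (inj₂ Xi) ¬Ai
    ... | inj₂ Yi = Yi
    Y⇒¬A : ∀ {i} → Y i → ¬ A i
    Y⇒¬A Yv (inj₁ refl) = v∉Y Yv
    Y⇒¬A Yi (inj₂ Xi)   = disjoint Xi Yi
    A∖v≐X : A ∖ ｛ v ｝ ≐ X
    A∖v≐X = (λ { (inj₁ refl , v≢v) → contradiction refl v≢v ; (inj₂ Xi , _) → Xi }) ,
            (λ { Xi → inj₂ Xi , λ { refl → v∉X Xi } })
    even-A : Even ∣ subset A? ∣
    even-A = suc k , (begin
      ∣ subset A? ∣            ≡⟨ ∣subset∣≡count A? ⟩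
      count A?                 ≡⟨ count-remove A? (inj₁ refl) ⟩
      suc (count (A? ─? v))    ≡⟨ cong suc (trans (count-cong (A? ─? v) X? A∖v≐X) |X|≡) ⟩
      suc (suc (2 * k))        ≡⟨ +2*-suc 0 k ⟩
      2 * suc k                ∎)
      where open ≡-Reasoning
    odd-B : Odd ∣ ∁ (subset A?) ∣
    odd-B = l , (begin
      ∣ ∁ (subset A?) ∣        ≡⟨ cong ∣_∣ (∁-subset A?) ⟩
      ∣ subset (∁? A?) ∣       ≡⟨ ∣subset∣≡count (∁? A?) ⟩
      count (∁? A?)            ≡⟨ count-cong (∁? A?) Y? (¬A⇒Y , Y⇒¬A) ⟩
      count Y?                 ≡⟨ |Y|≡ ⟩
      suc (2 * l)              ∎)
      where open ≡-Reasoning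
    ∈∁A⇒Y : ∀ {i} → i ∈ₛ ∁ (subset A?) → Y i
    ∈∁A⇒Y i∈ = ¬A⇒Y (∈-subset⁻ (∁? A?) (subst (_ ∈ₛ_) (∁-subset A?) i∈))
    A-clique : Clique G (subset A?)
    A-clique a b a∈ b∈ a≢b with ∈-subset⁻ A? a∈ | ∈-subset⁻ A? b∈
    ... | inj₁ refl | inj₁ refl = contradiction refl a≢b
    ... | inj₁ refl | inj₂ Xb   = v~X Xb
    ... | inj₂ Xa   | inj₁ refl = Adj-sym (v~X Xa)
    ... | inj₂ Xa   | inj₂ Xb   = X-clique Xa Xb a≢b
    B-clique : Clique G (∁ (subset A?))
    B-clique a b a∈ b∈ = Y-clique (∈∁A⇒Y a∈) (∈∁A⇒Y b∈)
    cross : ∀ a b → a ∈ₛ subset A? → b ∉ₛ subset A? → Adj G a b → (a ≡ v) ⊎ (b ≡ v)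
    cross a b a∈ b∉ a~b with ∈-subset⁻ A? a∈
    ... | inj₁ v≡a = inj₁ (sym v≡a)
    ... | inj₂ Xa  = contradiction a~b (no-cross Xa (¬A⇒Y (b∉ ∘ ∈-subset⁺ A?)))

  module _ (v : Fin n) where

    record IsMatching (m : Fin n → Fin n) : Set where
      field
        isInvolution : IsInvolution m
        adjacent     : ∀ {i} → m i ≢ i → Adj G i (m i)
        avoids       : m v ≡ v

      moved≢v : ∀ {i} → m i ≢ i → i ≢ v
      moved≢v mi≢i = fixed≢moved avoids mi≢i ∘ sym

    open IsMatching using (isInvolution; adjacent; avoids; moved≢v)

    Augmentable : (Fin n → Fin n) → Set
    Augmentable m = ∃ λ m′ → IsMatching m′ × unmatched m′ < unmatched m

    id-isMatching : IsMatching (λ i → i)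
    id-isMatching = record
      { isInvolution = record { involutive = λ _ → refl }
      ; adjacent     = λ i≢i → contradiction refl i≢i
      ; avoids       = refl
      }

    perfectMatching : ∀ {m} → IsMatching m → (∀ {i} → m i ≡ i → i ≡ v) → PerfectMatchingMinus G v
    perfectMatching {m} M only-v = m , λ i i≢v →
      (λ mi≡v → i≢v (injective (isInvolution M) (trans mi≡v (sym (avoids M))))) ,
      adjacent M (i≢v ∘ only-v) , involutive (isInvolution M) i

    match-isMatching : ∀ {m p q} → IsMatching m → m p ≡ p → m q ≡ q → Adj G p q → p ≢ v → q ≢ v →
                       IsMatching (match p q m)
    match-isMatching {m} {p} {q} M mp≡p mq≡q p~q p≢v q≢v = record
      { isInvolution = match-isInvolution mp≡p mq≡q (Adj⇒≢ p~q) (isInvolution M)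
      ; adjacent     = λ {i} moved → cases i moved (i ≟ p) (i ≟ q)
      ; avoids       = trans (match-elsewhere (p≢v ∘ sym) (q≢v ∘ sym)) (avoids M)
      }
      where
      cases : ∀ i → match p q m i ≢ i → Dec (i ≡ p) → Dec (i ≡ q) → Adj G i (match p q m i)
      cases i _ (yes refl) _ = subst (Adj G i) (sym match-at-p) p~q
      cases i _ (no _) (yes refl) = subst (Adj G i) (sym (match-at-q (Adj⇒≢ p~q))) (Adj-sym p~q)
      cases i moved (no i≢p) (no i≢q) = subst (Adj G i) (sym elsewhere) (adjacent M (moved ∘ trans elsewhere))
        where
        elsewhere : match p q m i ≡ m i
        elsewhere = match-elsewhere i≢p i≢q

    unmatch-isMatching : ∀ {m} → IsMatching m → ∀ a → IsMatching (unmatch a m)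
    unmatch-isMatching {m} M a = record
      { isInvolution = unmatch-isInvolution (isInvolution M)
      ; adjacent     = λ {i} moved → cases i moved (i ≟ a) (i ≟ m a)
      ; avoids       = unmatch-fixes (isInvolution M) (avoids M)
      }
      where
      cases : ∀ i → unmatch a m i ≢ i → Dec (i ≡ a) → Dec (i ≡ m a) → Adj G i (unmatch a m i)
      cases i moved (yes refl) _ = contradiction unmatch-at-a moved
      cases i moved (no _) (yes refl) = contradiction unmatch-at-partner moved
      cases i moved (no i≢a) (no i≢ma) = subst (Adj G i) (sym elsewhere) (adjacent M (moved ∘ trans elsewhere))
        where
        elsewhere : unmatch a m i ≡ m i
        elsewhere = unmatch-elsewhere i≢a i≢ma

    shift-isMatching : ∀ {m u a} → IsMatching m → m u ≡ u → u ≢ v → m a ≢ a → Adj G u a →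
                       IsMatching (shift u a m)
    shift-isMatching {a = a} M mu≡u u≢v ma≢a u~a =
      match-isMatching (unmatch-isMatching M a) (unmatch-fixes (isInvolution M) mu≡u) unmatch-at-a
                       u~a u≢v (moved≢v M ma≢a)

    augment-edge : ∀ {m u w} → IsMatching m → m u ≡ u → m w ≡ w → Adj G u w → u ≢ v → w ≢ v →
                   Augmentable m
    augment-edge {m} {u} {w} M mu≡u mw≡w u~w u≢v w≢v =
      match u w m , match-isMatching M mu≡u mw≡w u~w u≢v w≢v ,
      subst (unmatched (match u w m) <_) (sym (unmatched-match mu≡u mw≡w (Adj⇒≢ u~w))) (m<n⇒m<1+n (n<1+n _))

    augment-after-shift : ∀ {m u a} → IsMatching m → m u ≡ u → m a ≢ a →
                          Augmentable (shift u a m) → Augmentable m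
    augment-after-shift M mu≡u ma≢a (m′ , M′ , fewer) =
      m′ , M′ , subst (unmatched m′ <_) (unmatched-shift (isInvolution M) mu≡u ma≢a) fewer

    -- The augmenting path u — a ═ m a — w, where ═ is a matching edge.
    augment₃ : ∀ {m u w a} → IsMatching m → m u ≡ u → m w ≡ w → u ≢ w → u ≢ v → w ≢ v →
               m a ≢ a → Adj G u a → Adj G (m a) w → Augmentable m
    augment₃ {m} {u} {w} {a} M mu≡u mw≡w u≢w u≢v w≢v ma≢a u~a ma~w =
      augment-after-shift M mu≡u ma≢a
        (augment-edge (shift-isMatching M mu≡u u≢v ma≢a u~a) (shift-frees I mu≡u ma≢a) m₁w≡w ma~w
          (moved≢v M (partner-moved I ma≢a)) w≢v)
      where
      I : IsInvolution m
      I = isInvolution M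
      m₁w≡w : shift u a m w ≡ w
      m₁w≡w = trans (shift-elsewhere I mu≡u ma≢a (u≢w ∘ sym) (fixed≢moved mw≡w ma≢a)
                      (fixed≢moved mw≡w (partner-moved I ma≢a))) mw≡w

    -- The augmenting path u — m x ═ x — y ═ m y — w: shift along it twice, then match x with y.
    augment₅ : ∀ {m u w x y} → IsMatching m → m u ≡ u → m w ≡ w → u ≢ w → u ≢ v → w ≢ v →
               m x ≢ x → m y ≢ y → y ≢ m x → Adj G u (m x) → Adj G x y → Adj G (m y) w → Augmentable m
    augment₅ {m} {u} {w} {x} {y} M mu≡u mw≡w u≢w u≢v w≢v mx≢x my≢y y≢mx u~mx x~y my~w =
      augment-after-shift M mu≡u mmx≢mx
        (augment-after-shift M₁ m₁w≡w m₁my≢my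
          (augment-edge M₂ m₂x≡x m₂y≡y x~y (moved≢v M mx≢x) (moved≢v M my≢y)))
      where
      I : IsInvolution m
      I = isInvolution M
      x≢y : x ≢ y
      x≢y = Adj⇒≢ x~y
      mmx≢mx : m (m x) ≢ m x
      mmx≢mx = partner-moved I mx≢x
      m₁ : Fin n → Fin n
      m₁ = shift u (m x) m
      M₁ : IsMatching m₁
      M₁ = shift-isMatching M mu≡u u≢v mmx≢mx u~mx
      m₁-elsewhere : ∀ {i} → i ≢ u → i ≢ m x → i ≢ x → m₁ i ≡ m i
      m₁-elsewhere i≢u i≢mx i≢x =
        shift-elsewhere I mu≡u mmx≢mx i≢u i≢mx (i≢x ∘ flip trans (involutive I x))
      m₁x≡x : m₁ x ≡ x
      m₁x≡x = subst (λ j → m₁ j ≡ j) (involutive I x) (shift-frees I mu≡u mmx≢mx)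
      m₁w≡w : m₁ w ≡ w
      m₁w≡w = trans (m₁-elsewhere (u≢w ∘ sym) (fixed≢moved mw≡w mmx≢mx) (fixed≢moved mw≡w mx≢x)) mw≡w
      m₁my≡y : m₁ (m y) ≡ y
      m₁my≡y = trans (m₁-elsewhere (fixed≢moved mu≡u (partner-moved I my≢y) ∘ sym)
                       (x≢y ∘ sym ∘ injective I) (≢-partner I y≢mx)) (involutive I y)
      m₁my≢my : m₁ (m y) ≢ m y
      m₁my≢my m₁my≡my = my≢y (sym (trans (sym m₁my≡y) m₁my≡my))
      m₂ : Fin n → Fin n
      m₂ = shift w (m y) m₁
      M₂ : IsMatching m₂
      M₂ = shift-isMatching M₁ m₁w≡w w≢v m₁my≢my (Adj-sym my~w)
      m₂x≡x : m₂ x ≡ x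
      m₂x≡x = trans (shift-elsewhere (isInvolution M₁) m₁w≡w m₁my≢my (fixed≢moved mw≡w mx≢x ∘ sym)
                      (≢-partner I y≢mx ∘ sym) (x≢y ∘ flip trans m₁my≡y)) m₁x≡x
      m₂y≡y : m₂ y ≡ y
      m₂y≡y = subst (λ j → m₂ j ≡ j) m₁my≡y (shift-frees (isInvolution M₁) m₁w≡w m₁my≢my)

-- The augmentation argument

module _ {n : ℕ} (G : Graph n) (α≤2 : ∀ S → Independent G S → ∣ S ∣ ≤ 2) (v : Fin n) where

  open IsMatching using (isInvolution; avoids)

  module _ {m : Fin n → Fin n} (M : IsMatching G v m) {u w : Fin n}
           (mu≡u : m u ≡ u) (mw≡w : m w ≡ w) (u≢w : u ≢ w) (u≢v : u ≢ v) (w≢v : w ≢ v)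
           (only-vuw : ∀ {i} → m i ≡ i → i ≡ v ⊎ i ≡ u ⊎ i ≡ w) (u≁w : ¬ Adj G u w)
           (no-path₃ : ∀ {a} → m a ≢ a → Adj G u a → ¬ Adj G (m a) w)
           (no-path₅ : ∀ {x y} → m x ≢ x → m y ≢ y → y ≢ m x →
                       Adj G u (m x) → Adj G x y → ¬ Adj G (m y) w)
           where

    private
      I : IsInvolution m
      I = isInvolution M

      U W : Pred (Fin n) 0ℓ
      U i = i ≡ u ⊎ (m i ≢ i × Adj G u i)
      W i = i ≡ w ⊎ (m i ≢ i × ¬ Adj G u i)

      U? : Decidable U
      U? i = (i ≟ u) ⊎-dec (¬? (fixed? m i) ×-dec Adj? G u i)

      W? : Decidable W
      W? i = (i ≟ w) ⊎-dec (¬? (fixed? m i) ×-dec ¬? (Adj? G u i))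

      moved-adjacent-w : ∀ {a} → m a ≢ a → ¬ Adj G u a → Adj G w a
      moved-adjacent-w ma≢a =
        adjacent-of-non-neighbours G α≤2 u≢w (fixed≢moved mu≡u ma≢a) (fixed≢moved mw≡w ma≢a) u≁w

      partner-adjacent-u : ∀ {a} → m a ≢ a → Adj G u a → Adj G u (m a)
      partner-adjacent-u {a} ma≢a u~a = decidable-stable (Adj? G u (m a)) λ u≁ma →
        no-path₃ ma≢a u~a (Adj-sym G (moved-adjacent-w (partner-moved I ma≢a) u≁ma))

      U-closed : ∀ {i} → U i → U (m i)
      U-closed (inj₁ refl)         = inj₁ mu≡u
      U-closed (inj₂ (mi≢i , u~i)) = inj₂ (partner-moved I mi≢i , partner-adjacent-u mi≢i u~i)

      W-closed : ∀ {i} → W i → W (m i)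
      W-closed (inj₁ refl)         = inj₁ mw≡w
      W-closed {i} (inj₂ (mi≢i , u≁i)) = inj₂ (partner-moved I mi≢i , λ u~mi →
        u≁i (subst (Adj G u) (involutive I i) (partner-adjacent-u (partner-moved I mi≢i) u~mi)))

      U≁w : ∀ {a} → U a → ¬ Adj G w a
      U≁w (inj₁ refl) = u≁w ∘ Adj-sym G
      U≁w {a} (inj₂ (ma≢a , u~a)) w~a = no-path₃ (partner-moved I ma≢a) (partner-adjacent-u ma≢a u~a)
        (subst (λ j → Adj G j w) (sym (involutive I a)) (Adj-sym G w~a))

      W≁u : ∀ {a} → W a → ¬ Adj G u a
      W≁u (inj₁ refl)      = u≁w
      W≁u (inj₂ (_ , u≁a)) = u≁a

      W-adjacent-w : ∀ {a} → W a → a ≢ w → Adj G w a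
      W-adjacent-w (inj₁ refl)         w≢w = contradiction refl w≢w
      W-adjacent-w (inj₂ (ma≢a , u≁a)) _   = moved-adjacent-w ma≢a u≁a

      U≢w : ∀ {a} → U a → a ≢ w
      U≢w (inj₁ refl)      = u≢w
      U≢w (inj₂ (ma≢a , _)) = fixed≢moved mw≡w ma≢a ∘ sym

      W≢u : ∀ {a} → W a → a ≢ u
      W≢u (inj₁ refl)      = u≢w ∘ sym
      W≢u (inj₂ (ma≢a , _)) = fixed≢moved mu≡u ma≢a ∘ sym

      split : TwoCliquesMinus G v U W
      split = record
        { cover    = cover
        ; disjoint = disjoint
        ; v∉X      = λ { (inj₁ v≡u) → u≢v (sym v≡u) ; (inj₂ (mv≢v , _)) → mv≢v (avoids M) }
        ; v∉Y      = λ { (inj₁ v≡w) → w≢v (sym v≡w) ; (inj₂ (mv≢v , _)) → mv≢v (avoids M) }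
        ; X-clique = λ Ua Ub a≢b →
            adjacent-of-non-neighbours G α≤2 (U≢w Ua ∘ sym) (U≢w Ub ∘ sym) a≢b (U≁w Ua) (U≁w Ub)
        ; Y-clique = λ Wa Wb a≢b →
            adjacent-of-non-neighbours G α≤2 (W≢u Wa ∘ sym) (W≢u Wb ∘ sym) a≢b (W≁u Wa) (W≁u Wb)
        ; no-cross = no-cross
        }
        where
        cover : ∀ {i} → i ≢ v → U i ⊎ W i
        cover {i} i≢v with fixed? m i
        ... | yes mi≡i with only-vuw mi≡i
        ...   | inj₁ i≡v        = contradiction i≡v i≢v
        ...   | inj₂ (inj₁ i≡u) = inj₁ (inj₁ i≡u)
        ...   | inj₂ (inj₂ i≡w) = inj₂ (inj₁ i≡w)
        cover {i} i≢v | no mi≢i with Adj? G u i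
        ...   | yes u~i = inj₁ (inj₂ (mi≢i , u~i))
        ...   | no u≁i  = inj₂ (inj₂ (mi≢i , u≁i))
        disjoint : ∀ {i} → U i → ¬ W i
        disjoint (inj₁ refl)         (inj₁ u≡w)          = u≢w u≡w
        disjoint (inj₁ refl)         (inj₂ (mu≢u , _))   = mu≢u mu≡u
        disjoint (inj₂ (mw≢w , _))   (inj₁ refl)         = mw≢w mw≡w
        disjoint (inj₂ (_ , u~i))    (inj₂ (_ , u≁i))    = u≁i u~i
        no-cross : ∀ {a b} → U a → W b → ¬ Adj G a b
        no-cross (inj₁ refl) Wb = W≁u Wb
        no-cross (inj₂ Ua) (inj₁ refl) = U≁w (inj₂ Ua) ∘ Adj-sym G
        no-cross (inj₂ (ma≢a , u~a)) (inj₂ (mb≢b , u≁b)) a~b =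
          no-path₅ ma≢a mb≢b (λ b≡ma → u≁b (subst (Adj G u) (sym b≡ma) (partner-adjacent-u ma≢a u~a)))
            (partner-adjacent-u ma≢a u~a) a~b
            (Adj-sym G (W-adjacent-w (W-closed (inj₂ (mb≢b , u≁b)))
                                     (fixed≢moved mw≡w (partner-moved I mb≢b) ∘ sym)))

      odd-U : Odd (count U?)
      odd-U = fixed-points-parity I U? U-closed ([] ∷ [])
        ((λ { (inj₁ refl , _) → here refl ; (inj₂ (mi≢i , _) , mi≡i) → contradiction mi≡i mi≢i }) ,
         (λ { (here refl) → inj₁ refl , mu≡u }))

      odd-W : Odd (count W?)
      odd-W = fixed-points-parity I W? W-closed ([] ∷ [])
        ((λ { (inj₁ refl , _) → here refl ; (inj₂ (mi≢i , _) , mi≡i) → contradiction mi≡i mi≢i }) ,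
         (λ { (here refl) → inj₁ refl , mw≡w }))

    no-short-augmentation⇒twoCliquesStar : TwoCliquesStar G
    no-short-augmentation⇒twoCliquesStar with any? (λ a → U? a ×-dec ¬? (Adj? G v a))
    ... | no ∄a = twoCliquesStar G U? W? split v~U odd-U odd-W
      where
      v~U : ∀ {a} → U a → Adj G v a
      v~U {a} Ua = decidable-stable (Adj? G v a) λ v≁a → ∄a (a , Ua , v≁a)
    ... | yes (a , Ua , v≁a) = twoCliquesStar G W? U? (swap-sides G split) v~W odd-W odd-U
      where
      open TwoCliquesMinus split
      v~W : ∀ {b} → W b → Adj G v b
      v~W {b} Wb = decidable-stable (Adj? G v b) λ v≁b →
        no-independent-triple G α≤2 (λ { refl → v∉X Ua }) (λ { refl → v∉Y Wb }) (λ { refl → disjoint Ua Wb })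
          v≁a v≁b (no-cross Ua Wb)

  augment-or-twoCliquesStar : ∀ {m} (M : IsMatching G v m) {u w : Fin n} →
    m u ≡ u → m w ≡ w → u ≢ w → u ≢ v → w ≢ v → (∀ {i} → m i ≡ i → i ≡ v ⊎ i ≡ u ⊎ i ≡ w) →
    Augmentable G v m ⊎ TwoCliquesStar G
  augment-or-twoCliquesStar {m} M {u} {w} mu≡u mw≡w u≢w u≢v w≢v only-vuw with Adj? G u w
  ... | yes u~w = inj₁ (augment-edge G v M mu≡u mw≡w u~w u≢v w≢v)
  ... | no u≁w with any? (λ a → ¬? (fixed? m a) ×-dec Adj? G u a ×-dec Adj? G (m a) w)
  ...   | yes (a , ma≢a , u~a , ma~w) = inj₁ (augment₃ G v M mu≡u mw≡w u≢w u≢v w≢v ma≢a u~a ma~w)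
  ...   | no ∄a with any? (λ x → any? (λ y →
                   ¬? (fixed? m x) ×-dec ¬? (fixed? m y) ×-dec ¬? (y ≟ m x) ×-dec
                   Adj? G u (m x) ×-dec Adj? G x y ×-dec Adj? G (m y) w))
  ...     | yes (x , y , mx≢x , my≢y , y≢mx , u~mx , x~y , my~w) =
              inj₁ (augment₅ G v M mu≡u mw≡w u≢w u≢v w≢v mx≢x my≢y y≢mx u~mx x~y my~w)
  ...     | no ∄xy = inj₂ (no-short-augmentation⇒twoCliquesStar M mu≡u mw≡w u≢w u≢v w≢v only-vuw u≁w
              (λ ma≢a u~a ma~w → ∄a (_ , ma≢a , u~a , ma~w))
              (λ mx≢x my≢y y≢mx u~mx x~y my~w → ∄xy (_ , _ , mx≢x , my≢y , y≢mx , u~mx , x~y , my~w)))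

  augment-among-three : ∀ {m} (M : IsMatching G v m) {u w i : Fin n} →
    m u ≡ u → m w ≡ w → m i ≡ i → u ≢ w → u ≢ i → w ≢ i → u ≢ v → w ≢ v → i ≢ v →
    Augmentable G v m
  augment-among-three M {u} {w} {i} mu≡u mw≡w mi≡i u≢w u≢i w≢i u≢v w≢v i≢v
    with Adj? G u w | Adj? G u i | Adj? G w i
  ... | yes u~w | _       | _       = augment-edge G v M mu≡u mw≡w u~w u≢v w≢v
  ... | no _    | yes u~i | _       = augment-edge G v M mu≡u mi≡i u~i u≢v i≢v
  ... | no _    | no _    | yes w~i = augment-edge G v M mw≡w mi≡i w~i w≢v i≢v
  ... | no u≁w  | no u≁i  | no w≁i  = contradiction w≁i (no-independent-triple G α≤2 u≢w u≢i w≢i u≁w u≁i)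

  module _ (odd : Odd n) where

    matching-trichotomy : ∀ {m} → IsMatching G v m →
                          PerfectMatchingMinus G v ⊎ Augmentable G v m ⊎ TwoCliquesStar G
    matching-trichotomy {m} M with any? (λ u → fixed? m u ×-dec ¬? (u ≟ v))
    ... | no ∄u =
      inj₁ (perfectMatching G v M λ {i} mi≡i → decidable-stable (i ≟ v) λ i≢v → ∄u (i , mi≡i , i≢v))
    ... | yes (u , mu≡u , u≢v) with any? (λ w → fixed? m w ×-dec ¬? (w ≟ v) ×-dec ¬? (w ≟ u))
    ...   | no ∄w = contradiction (two-fixed-points⇒even (isInvolution M) (u≢v ∘ sym) only-vu) odd⇒¬even
      where
      only-vu : Fixed m ≐ (_∈ₗ v ∷ u ∷ [])
      only-vu = (λ {i} mi≡i → decidable-stable (i ∈? v ∷ u ∷ []) λ i∉ →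
                    ∄w (i , mi≡i , i∉ ∘ here , i∉ ∘ there ∘ here)) ,
                (λ { (here refl) → avoids M ; (there (here refl)) → mu≡u })
      odd⇒¬even : ¬ Even n
      odd⇒¬even (j , n≡2j) = even≢odd j (proj₁ odd) (trans (sym n≡2j) (proj₂ odd))
    ...   | yes (w , mw≡w , w≢v , w≢u)
      with any? (λ i → fixed? m i ×-dec ¬? (i ≟ v) ×-dec ¬? (i ≟ u) ×-dec ¬? (i ≟ w))
    ...     | yes (i , mi≡i , i≢v , i≢u , i≢w) =
                inj₂ (inj₁ (augment-among-three M mu≡u mw≡w mi≡i (w≢u ∘ sym) (i≢u ∘ sym) (i≢w ∘ sym)
                                                u≢v w≢v i≢v))
    ...     | no ∄i = inj₂ (augment-or-twoCliquesStar M mu≡u mw≡w (w≢u ∘ sym) u≢v w≢v only-vuw)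
      where
      only-vuw : ∀ {i} → m i ≡ i → i ≡ v ⊎ i ≡ u ⊎ i ≡ w
      only-vuw {i} mi≡i = decidable-stable ((i ≟ v) ⊎-dec (i ≟ u) ⊎-dec (i ≟ w)) λ none →
        ∄i (i , mi≡i , none ∘ inj₁ , none ∘ inj₂ ∘ inj₁ , none ∘ inj₂ ∘ inj₂)

    perfectMatching-or-twoCliquesStar : PerfectMatchingMinus G v ⊎ TwoCliquesStar G
    perfectMatching-or-twoCliquesStar = <-rec Goal improve _ (id-isMatching G v) refl
      where
      Goal : ℕ → Set
      Goal c = ∀ {m} → IsMatching G v m → unmatched m ≡ c → PerfectMatchingMinus G v ⊎ TwoCliquesStar G
      improve : ∀ c → (∀ {c′} → c′ < c → Goal c′) → Goal c
      improve _ rec M refl with matching-trichotomy M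
      ... | inj₁ perfect                 = inj₁ perfect
      ... | inj₂ (inj₁ (_ , M′ , fewer)) = rec fewer M′ refl
      ... | inj₂ (inj₂ star)             = inj₂ star

∀-⊎-const : ∀ {n} {P : Fin n → Set} {Q : Set} → (∀ i → P i ⊎ Q) → (∀ i → P i) ⊎ Q
∀-⊎-const {zero}  f = inj₁ λ ()
∀-⊎-const {suc n} f with f zero | ∀-⊎-const (f ∘ suc)
... | inj₂ q  | _       = inj₂ q
... | inj₁ _  | inj₂ q  = inj₂ q
... | inj₁ p₀ | inj₁ ps = inj₁ λ { zero → p₀ ; (suc i) → ps i }

proposition14 : ∀ (n : ℕ) (G : Graph n) → Odd n → Connected G →
    IndependenceNumber G 2 → FactorCritical G ⊎ TwoCliquesStar G
proposition14 n G odd _ (_ , α≤2) = ∀-⊎-const λ v → perfectMatching-or-twoCliquesStar G α≤2 v odd
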